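{- Let $n\ge1$, let $t$ be an $n$-labeled, binary, increasing, topological tree, and let $\sigma=\sigma(1)\cdots\sigma(n)$ be its projection. Then $\mathrm{pom}(t)=\mathrm{grn}(\sigma)$; that is, the label of the parent of the leaf labeled $n$ in $t$ equals the greater neighbor of $n$ in $\sigma$.
   Context: An $n$-labeled, binary, increasing, topological tree is a planar rooted tree with $n$ nodes labeled $1,\dots,n$ (the root labeled $1$), in which each node has zero, one or two children, each child being designated as left or right child, the label of every node is smaller than the labels of its children, and: if $n$ is odd, every node is a leaf or has two children; if $n$ is even, every node is a leaf or has two children, except the rightmost node (the end of the path from the root always going to the right child), which has exactly one child, a left child. Draw the tree in the plane with the root at $(0,0)$ and, for a node at depth $d$ with abscissa $x$, its left and right children at depth $d+1$ with abscissas $x-2^{ -d}$ and $x+2^{ -d}$; all nodes get distinct abscissas. The projection of the tree is the word $\sigma(1)\cdots\sigma(n)$ obtained by reading the labels of the nodes in increasing order of abscissa (this is a permutation of $\{1,\dots,n\}$, and it is alternating). $\mathrm{pom}(t)$ is the label of the parent of the (unique) leaf labeled $n$, with the convention $\mathrm{pom}(t)=0$ when $n=1$. For a permutation $\sigma$ with $\sigma(i)=n$, set $\sigma(0)=\sigma(n+1):=0$ and $\mathrm{grn}(\sigma):=\max\{\sigma(i-1),\sigma(i+1)\}$. -}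

module Defs where

open import Data.Nat using (ℕ; zero; suc; _<_; _≡ᵇ_; _⊔_)
open import Data.Bool using (Bool; true; false; if_then_else_; T; not)
open import Data.Maybe using (Maybe; just; nothing; _<∣>_; fromMaybe)
open import Data.List using (List; []; _∷_; _++_; map; upTo; [_])
open import Data.Product using (Σ; _×_; _,_; proj₁; proj₂; ∃)
open import Data.Unit using (⊤)
open import Data.List.Relation.Binary.Permutation.Propositional using (_↭_)
open import Data.List.Relation.Unary.Linked using (Linked)
open import Relation.Binary.PropositionalEquality using (_≡_)
import Data.Rational as Q

-- Planar binary trees with ℕ labels.  `∅` is the empty (absent) subtree;
-- `nd l a r` is a node labelled a with left subtree l and right subtree r.
-- A node is a leaf iff both its subtrees are ∅.

data BT : Set where
  ∅  : BT
  nd : BT → ℕ → BT → BT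

data Full : BT → Set where
  leafF : ∀ a → Full (nd ∅ a ∅)
  binF  : ∀ {l r} a → Full l → Full r → Full (nd l a r)

-- Every node is a leaf or has two children, except the rightmost node
-- (end of the rightward path from the root), which has exactly one child,
-- a left child.
data EvenShape : BT → Set where
  endE  : ∀ {l} a → Full l → EvenShape (nd l a ∅)
  stepE : ∀ {l r} a → Full l → EvenShape r → EvenShape (nd l a r)

isEven : ℕ → Bool
isEven zero = true
isEven (suc zero) = false
isEven (suc (suc n)) = isEven n

ShapeOK : ℕ → BT → Set
ShapeOK n t = (T (isEven n) → EvenShape t) × (T (not (isEven n)) → Full t)

Below : ℕ → BT → Set
Below a ∅ = ⊤
Below a (nd _ b _) = a < b

data Increasing : BT → Set where
  inc∅  : Increasing ∅
  incNd : ∀ {l a r} → Below a l → Below a r →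
          Increasing l → Increasing r → Increasing (nd l a r)

labels : BT → List ℕ
labels ∅ = []
labels (nd l a r) = a ∷ labels l ++ labels r

IBTTree : ℕ → BT → Set
IBTTree n t =
  (labels t ↭ map suc (upTo n)) ×
  (Σ BT λ l → Σ BT λ r → t ≡ nd l 1 r) ×
  Increasing t ×
  ShapeOK n t

-- Drawing in the plane.  A node is addressed by its path from the root.

data Dir : Set where
  L R : Dir

Path : Set
Path = List Dir

pow½ : ℕ → Q.ℚ
pow½ zero = Q.1ℚ
pow½ (suc d) = Q.½ Q.* pow½ d

absFrom : ℕ → Q.ℚ → Path → Q.ℚ
absFrom d x [] = x
absFrom d x (L ∷ p) = absFrom (suc d) (x Q.- pow½ d) p
absFrom d x (R ∷ p) = absFrom (suc d) (x Q.+ pow½ d) p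

abscissa : Path → Q.ℚ
abscissa = absFrom 0 Q.0ℚ

nodesFrom : Path → BT → List (Path × ℕ)
nodesFrom p ∅ = []
nodesFrom p (nd l a r) = (p , a) ∷ nodesFrom (p ++ [ L ]) l ++ nodesFrom (p ++ [ R ]) r

nodes : BT → List (Path × ℕ)
nodes = nodesFrom []

IsProjection : BT → List ℕ → Set
IsProjection t σ =
  Σ (List (Path × ℕ)) λ ps →
    (ps ↭ nodes t) ×
    Linked (λ u v → abscissa (proj₁ u) Q.< abscissa (proj₁ v)) ps ×
    (map proj₂ ps ≡ σ)

rootLabel : BT → Maybe ℕ
rootLabel ∅ = nothing
rootLabel (nd _ a _) = just a

isLabel : ℕ → Maybe ℕ → Bool
isLabel n nothing = false
isLabel n (just b) = b ≡ᵇ n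

parentOf : ℕ → BT → Maybe ℕ
parentOf n ∅ = nothing
parentOf n (nd l a r) =
  if isLabel n (rootLabel l) then just a
  else if isLabel n (rootLabel r) then just a
  else (parentOf n l <∣> parentOf n r)

-- pom(t) for an n-labeled tree; 0 when the node n has no parent (n = 1)
pom : ℕ → BT → ℕ
pom n t = fromMaybe 0 (parentOf n t)

-- grn(σ) = max(σ(i-1), σ(i+1)) where σ(i) = n, with σ(0)=σ(n+1)=0
headOr0 : List ℕ → ℕ
headOr0 [] = 0
headOr0 (x ∷ _) = x

grnFrom : ℕ → ℕ → List ℕ → ℕ
grnFrom n prev [] = 0
grnFrom n prev (x ∷ xs) = if x ≡ᵇ n then prev ⊔ headOr0 xs else grnFrom n x xs

grn : ℕ → List ℕ → ℕ
grn n σ = grnFrom n 0 σ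

module Submission where

-- A node at depth d and abscissa x has its whole subtree within
-- distance 2·2^{-d} of x, its left subtree strictly to the left of x and its
-- right subtree strictly to the right.  Hence the in-order traversal
-- (left subtree, root, right subtree) lists the nodes by increasing
-- abscissa; a list strictly sorted by an asymmetric relation is determined
-- by its elements, so the projection σ is the in-order word of t.
--
-- Only three properties of t are used: it is increasing,
-- its labels are distinct, and all of them are ≤ n.  For a subtree with root a containing n, placed in the
-- word between a letter prev and letters rest that are both ≤ a, the
-- greater neighbour of n equals the parent of n (induction on the subtree),
-- where the parent of the subtree root counts as max(prev, first of rest).
-- Descending into the child containing n keeps this invariant because the
-- neighbours of that child in the word are a and the old outer neighbours,
-- all ≤ a < the child's root.  The theorem is the case of the whole tree,
-- whose outer neighbours are the sentinels σ(0) = σ(n+1) = 0.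

open import Defs
open import Data.Nat as ℕ using (ℕ; zero; suc; _≤_; _⊔_; _≡ᵇ_; _≟_; z≤n)
open import Data.Nat.Properties
  using (≡ᵇ⇒≡; ≡⇒≡ᵇ; suc-injective; <⇒≤; <⇒≱; ≤-trans; n<1+n; +-suc;
         m≤n⇒m⊔n≡n; m≥n⇒m⊔n≡m)
open import Data.Bool using (true; false; T)
open import Data.Bool.Properties using (¬-not; T-≡)
open import Data.Maybe using (just; nothing; fromMaybe)
open import Data.Maybe.Properties using (<∣>-identityʳ)
open import Data.List using (List; []; _∷_; _++_; [_]; length; map; upTo)
open import Data.List.Properties using (++-assoc; ++-identityʳ; map-++)
open import Data.List.Membership.Propositional using (_∈_; _∉_)
open import Data.List.Membership.Propositional.Properties
  using (∈-++⁻; ∈-++⁺ˡ; ∈-++⁺ʳ; ∈-map⁺; ∈-upTo⁻; ∈-upTo⁺)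
open import Data.List.Relation.Unary.All as All using (All; []; _∷_)
import Data.List.Relation.Unary.All.Properties as All
open import Data.List.Relation.Unary.Any using (here; there)
open import Data.List.Relation.Unary.AllPairs using (AllPairs; []; _∷_)
import Data.List.Relation.Unary.AllPairs.Properties as AllPairs
open import Data.List.Relation.Unary.Linked.Properties using (Linked⇒AllPairs)
open import Data.List.Relation.Unary.Unique.Propositional using (Unique)
import Data.List.Relation.Unary.Unique.Propositional.Properties as Unique
open import Data.List.Relation.Binary.Disjoint.Propositional using (Disjoint)
open import Data.List.Relation.Binary.Permutation.Propositional
  using (_↭_; prep; ↭-sym; ↭-trans; ↭-refl; ↭⇒↭ₛ)
open import Data.List.Relation.Binary.Permutation.Propositional.Properties
  using (∈-resp-↭; All-resp-↭; shift; ++⁺; drop-∷)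
import Data.List.Relation.Binary.Permutation.Setoid.Properties as PermutationSetoid
open import Data.Product using (Σ; _×_; _,_; proj₁; proj₂)
open import Data.Sum using (_⊎_; inj₁; inj₂)
open import Data.Empty using (⊥-elim)
open import Function using (_∘_; Equivalence)
open import Relation.Nullary using (yes; no)
open import Relation.Binary.Definitions using (Asymmetric)
open import Relation.Binary.PropositionalEquality
  using (_≡_; _≢_; refl; sym; trans; cong; cong₂; subst; setoid; module ≡-Reasoning)
import Data.Rational as ℚ
open ℚ using (ℚ; 0ℚ; ½; _+_; _-_; _<_; Positive)
import Data.Rational.Properties as ℚP
open import Data.Rational.Solver using (module +-*-Solver)
open +-*-Solver using (solve; _:+_; _:-_; _:=_)


pow½-positive : ∀ d → Positive (pow½ d)
pow½-positive zero    = _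
pow½-positive (suc d) = ℚP.pos*pos⇒pos ½ (pow½ d) {{pow½-positive d}}

pow½-halves : ∀ d → pow½ (suc d) + pow½ (suc d) ≡ pow½ d
pow½-halves d = trans (sym (ℚP.*-distribʳ-+ (pow½ d) ½ ½)) (ℚP.*-identityˡ (pow½ d))

-- The reach 2·2^{-d} of a node at depth d: its subtree stays strictly
-- closer than this to it.
reach : ℕ → ℚ
reach d = pow½ d + pow½ d

reach-positive : ∀ d → 0ℚ < reach d
reach-positive d =
  ℚP.positive⁻¹ _ {{ℚP.pos+pos⇒pos (pow½ d) {{pow½-positive d}} (pow½ d) {{pow½-positive d}}}}

<-plus-positive : ∀ x {w} → 0ℚ < w → x < x + w
<-plus-positive x 0<w = ℚP.<-respˡ-≡ (ℚP.+-identityʳ x) (ℚP.+-monoʳ-< x 0<w)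

minus-positive-< : ∀ x {w} → 0ℚ < w → x - w < x
minus-positive-< x 0<w =
  ℚP.<-respʳ-≡ (ℚP.+-identityʳ x) (ℚP.+-monoʳ-< x (ℚP.neg-antimono-< 0<w))

sub-twice : ∀ x h → x - (h + h) ≡ (x - h) - h
sub-twice = solve 2 (λ x h → x :- (h :+ h) := (x :- h) :- h) refl

sub-add : ∀ x h → (x - h) + h ≡ x
sub-add = solve 2 (λ x h → (x :- h) :+ h := x) refl

add-sub : ∀ x h → (x + h) - h ≡ x
add-sub = solve 2 (λ x h → (x :+ h) :- h := x) refl

add-twice : ∀ x h → (x + h) + h ≡ x + (h + h)
add-twice = solve 2 (λ x h → (x :+ h) :+ h := x :+ (h :+ h)) refl

absFrom-within : ∀ d x s → (x - reach d < absFrom d x s) × (absFrom d x s < x + reach d)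
left-branch    : ∀ d x s → (x - reach d < absFrom d x (L ∷ s)) × (absFrom d x (L ∷ s) < x)
right-branch   : ∀ d x s → (x < absFrom d x (R ∷ s)) × (absFrom d x (R ∷ s) < x + reach d)

absFrom-within d x [] = minus-positive-< x (reach-positive d) , <-plus-positive x (reach-positive d)
absFrom-within d x (L ∷ s) with left-branch d x s
... | lo , hi = lo , ℚP.<-trans hi (<-plus-positive x (reach-positive d))
absFrom-within d x (R ∷ s) with right-branch d x s
... | lo , hi = ℚP.<-trans (minus-positive-< x (reach-positive d)) lo , hi

left-branch d x s with absFrom-within (suc d) (x - pow½ d) s
... | lo , hi rewrite pow½-halves d =
  ℚP.<-respˡ-≡ (sym (sub-twice x (pow½ d))) lo , ℚP.<-respʳ-≡ (sub-add x (pow½ d)) hi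

right-branch d x s with absFrom-within (suc d) (x + pow½ d) s
... | lo , hi rewrite pow½-halves d =
  ℚP.<-respˡ-≡ (add-sub x (pow½ d)) lo , ℚP.<-respʳ-≡ (add-twice x (pow½ d)) hi

absFrom-++ : ∀ d x p q → absFrom d x (p ++ q) ≡ absFrom (length p ℕ.+ d) (absFrom d x p) q
absFrom-++ d x [] q = refl
absFrom-++ d x (L ∷ p) q = trans (absFrom-++ (suc d) (x - pow½ d) p q)
  (cong (λ k → absFrom k (absFrom (suc d) (x - pow½ d) p) q) (+-suc (length p) d))
absFrom-++ d x (R ∷ p) q = trans (absFrom-++ (suc d) (x + pow½ d) p q)
  (cong (λ k → absFrom k (absFrom (suc d) (x + pow½ d) p) q) (+-suc (length p) d))

abscissa-left : ∀ p s → abscissa ((p ++ [ L ]) ++ s) < abscissa p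
abscissa-left p s rewrite ++-assoc p [ L ] s | absFrom-++ 0 0ℚ p (L ∷ s) =
  proj₂ (left-branch _ _ s)

abscissa-right : ∀ p s → abscissa p < abscissa ((p ++ [ R ]) ++ s)
abscissa-right p s rewrite ++-assoc p [ R ] s | absFrom-++ 0 0ℚ p (R ∷ s) =
  proj₁ (right-branch _ _ s)


inorder : Path → BT → List (Path × ℕ)
inorder p ∅          = []
inorder p (nd l a r) = inorder (p ++ [ L ]) l ++ (p , a) ∷ inorder (p ++ [ R ]) r

inorder-↭-nodes : ∀ p t → inorder p t ↭ nodesFrom p t
inorder-↭-nodes p ∅          = ↭-refl
inorder-↭-nodes p (nd l a r) = ↭-trans (shift (p , a) (inorder (p ++ [ L ]) l) _)
  (prep (p , a) (++⁺ (inorder-↭-nodes _ l) (inorder-↭-nodes _ r)))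

Extends : Path → Path × ℕ → Set
Extends q u = Σ Path λ s → proj₁ u ≡ q ++ s

inorder-extends : ∀ q t → All (Extends q) (inorder q t)
inorder-extends q ∅          = []
inorder-extends q (nd l a r) =
  All.++⁺ (All.map (λ {u} → extendL {u}) (inorder-extends (q ++ [ L ]) l))
          (([] , sym (++-identityʳ q)) ∷ All.map (λ {u} → extendR {u}) (inorder-extends (q ++ [ R ]) r))
  where
  extendL : ∀ {u} → Extends (q ++ [ L ]) u → Extends q u
  extendL (s , e) = L ∷ s , trans e (++-assoc q [ L ] s)
  extendR : ∀ {u} → Extends (q ++ [ R ]) u → Extends q u
  extendR (s , e) = R ∷ s , trans e (++-assoc q [ R ] s)

LeftOf : Path × ℕ → Path × ℕ → Set
LeftOf u v = abscissa (proj₁ u) < abscissa (proj₁ v)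

left-subtree-left : ∀ p l → All (λ u → abscissa (proj₁ u) < abscissa p) (inorder (p ++ [ L ]) l)
left-subtree-left p l = All.map
  (λ { (s , e) → subst (λ z → abscissa z < abscissa p) (sym e) (abscissa-left p s) })
  (inorder-extends _ l)

right-subtree-right : ∀ p r → All (λ u → abscissa p < abscissa (proj₁ u)) (inorder (p ++ [ R ]) r)
right-subtree-right p r = All.map
  (λ { (s , e) → subst (λ z → abscissa p < abscissa z) (sym e) (abscissa-right p s) })
  (inorder-extends _ r)

inorder-sorted : ∀ p t → AllPairs LeftOf (inorder p t)
inorder-sorted p ∅          = []
inorder-sorted p (nd l a r) =
  AllPairs.++⁺ (inorder-sorted _ l) (right-subtree-right p r ∷ inorder-sorted _ r)
    (All.map (λ u<p → u<p ∷ All.map (ℚP.<-trans u<p) (right-subtree-right p r))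
             (left-subtree-left p l))

sorted-unique : ∀ {a ℓ} {A : Set a} {R : A → A → Set ℓ} → Asymmetric R →
                ∀ {xs ys} → AllPairs R xs → AllPairs R ys → xs ↭ ys → xs ≡ ys
sorted-unique asym {[]} {[]} _ _ _ = refl
sorted-unique asym {[]} {y ∷ ys} _ _ p with ∈-resp-↭ (↭-sym p) (here refl)
... | ()
sorted-unique asym {x ∷ xs} {[]} _ _ p with ∈-resp-↭ p (here refl)
... | ()
sorted-unique asym {x ∷ xs} {y ∷ ys} (x< ∷ sxs) (y< ∷ sys) p
  with ∈-resp-↭ p (here refl) | ∈-resp-↭ (↭-sym p) (here refl)
... | here refl  | _          = cong (x ∷_) (sorted-unique asym sxs sys (drop-∷ p))
... | there _    | here refl  = cong (x ∷_) (sorted-unique asym sxs sys (drop-∷ p))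
... | there x∈ys | there y∈xs = ⊥-elim (asym (All.lookup x< y∈xs) (All.lookup y< x∈ys))

word : BT → List ℕ
word ∅          = []
word (nd l a r) = word l ++ a ∷ word r

inorder-word : ∀ p t → map proj₂ (inorder p t) ≡ word t
inorder-word p ∅          = refl
inorder-word p (nd l a r) = trans (map-++ proj₂ (inorder _ l) _)
  (cong₂ (λ u v → u ++ a ∷ v) (inorder-word _ l) (inorder-word _ r))

word-↭-labels : ∀ t → word t ↭ labels t
word-↭-labels ∅          = ↭-refl
word-↭-labels (nd l a r) =
  ↭-trans (shift a (word l) (word r)) (prep a (++⁺ (word-↭-labels l) (word-↭-labels r)))

projection-is-word : ∀ t σ → IsProjection t σ → σ ≡ word t
projection-is-word t σ (ps , ps↭ , linked , refl) = begin
  map proj₂ ps              ≡⟨ cong (map proj₂) ps≡inorder ⟩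
  map proj₂ (inorder [] t)  ≡⟨ inorder-word [] t ⟩
  word t                    ∎
  where
  open ≡-Reasoning
  ps≡inorder : ps ≡ inorder [] t
  ps≡inorder = sorted-unique ℚP.<-asym (Linked⇒AllPairs ℚP.<-trans linked)
    (inorder-sorted [] t) (↭-trans ps↭ (↭-sym (inorder-↭-nodes [] t)))



≡ᵇ-refl : ∀ n → (n ≡ᵇ n) ≡ true
≡ᵇ-refl n = Equivalence.to T-≡ (≡⇒≡ᵇ n n refl)

≡ᵇ-false : ∀ {m n} → m ≢ n → (m ≡ᵇ n) ≡ false
≡ᵇ-false {m} {n} m≢n = ¬-not (λ m≡ᵇn → m≢n (≡ᵇ⇒≡ m n (subst T (sym m≡ᵇn) _)))

grnFrom-hit : ∀ {n} prev ys → grnFrom n prev (n ∷ ys) ≡ prev ⊔ headOr0 ys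
grnFrom-hit {n} prev ys rewrite ≡ᵇ-refl n = refl

grnFrom-miss : ∀ {n x} prev ys → x ≢ n → grnFrom n prev (x ∷ ys) ≡ grnFrom n x ys
grnFrom-miss prev ys x≢n rewrite ≡ᵇ-false x≢n = refl

grnFrom-pass : ∀ {n x} prev xs ys → n ∉ xs → x ≢ n →
               grnFrom n prev (xs ++ x ∷ ys) ≡ grnFrom n x ys
grnFrom-pass prev []       ys n∉xs x≢n = grnFrom-miss prev ys x≢n
grnFrom-pass prev (y ∷ xs) ys n∉yxs x≢n =
  trans (grnFrom-miss prev (xs ++ _ ∷ ys) (λ y≡n → n∉yxs (here (sym y≡n))))
        (grnFrom-pass y xs ys (n∉yxs ∘ there) x≢n)


∈-left : ∀ {x l a r} → x ∈ labels l → x ∈ labels (nd l a r)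
∈-left = there ∘ ∈-++⁺ˡ

∈-right : ∀ {x l a r} → x ∈ labels r → x ∈ labels (nd l a r)
∈-right {l = l} = there ∘ ∈-++⁺ʳ (labels l)

child-side : ∀ {n} l a r → a ≢ n → n ∈ labels (nd l a r) → n ∈ labels l ⊎ n ∈ labels r
child-side l a r a≢n (here n≡a)  = ⊥-elim (a≢n (sym n≡a))
child-side l a r a≢n (there n∈) = ∈-++⁻ (labels l) n∈

unique-++⁻ : ∀ {A : Set} (xs : List A) {ys} → Unique (xs ++ ys) →
             Unique xs × Unique ys × Disjoint xs ys
unique-++⁻ []       u              = [] , u , λ ()
unique-++⁻ (x ∷ xs) (x∉xsys ∷ u) with unique-++⁻ xs u
... | uxs , uys , disjoint =
  All.++⁻ˡ xs x∉xsys ∷ uxs , uys ,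
  λ { (here refl , v∈ys)  → All.lookup x∉xsys (∈-++⁺ʳ xs v∈ys) refl
    ; (there v∈xs , v∈ys) → disjoint (v∈xs , v∈ys) }

WellLabelled : ℕ → BT → Set
WellLabelled n t = Increasing t × Unique (labels t) × All (_≤ n) (labels t)

left-part : ∀ {n l a r} → WellLabelled n (nd l a r) → WellLabelled n l
left-part {l = l} (incNd _ _ inc-l _ , _ ∷ u , _ ∷ bounded) =
  inc-l , proj₁ (unique-++⁻ (labels l) u) , All.++⁻ˡ (labels l) bounded

right-part : ∀ {n l a r} → WellLabelled n (nd l a r) → WellLabelled n r
right-part {l = l} (incNd _ _ _ inc-r , _ ∷ u , _ ∷ bounded) =
  inc-r , proj₁ (proj₂ (unique-++⁻ (labels l) u)) , All.++⁻ʳ (labels l) bounded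

subtrees-disjoint : ∀ {n l a r x} → WellLabelled n (nd l a r) →
                    x ∈ labels l → x ∉ labels r
subtrees-disjoint {l = l} (_ , _ ∷ u , _) x∈l x∈r =
  proj₂ (proj₂ (unique-++⁻ (labels l) u)) (x∈l , x∈r)

-- Nothing sits above the maximal label n, so a node labelled n is a leaf.
nothing-above : ∀ {n} t → Below n t → All (_≤ n) (labels t) → t ≡ ∅
nothing-above ∅            _   _             = refl
nothing-above (nd _ b _) n<b (b≤n ∷ _) = ⊥-elim (<⇒≱ n<b b≤n)

maximum-is-leaf : ∀ {n l r} → WellLabelled n (nd l n r) → l ≡ ∅ × r ≡ ∅
maximum-is-leaf {l = l} {r} (incNd n<l n<r _ _ , _ , _ ∷ bounded) =
  nothing-above l n<l (All.++⁻ˡ (labels l) bounded) ,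
  nothing-above r n<r (All.++⁻ʳ (labels l) bounded)

well-labelled : ∀ {n t} → labels t ↭ map suc (upTo n) → Increasing t → WellLabelled n t
well-labelled {n} perm inc =
  inc ,
  PermutationSetoid.Unique-resp-↭ (setoid ℕ) (↭⇒↭ₛ (↭-sym perm))
    (Unique.map⁺ suc-injective (Unique.upTo⁺ n)) ,
  All-resp-↭ (↭-sym perm) (All.map⁺ (All.tabulate ∈-upTo⁻))

maximum-present : ∀ {k t} → labels t ↭ map suc (upTo (suc k)) → suc k ∈ labels t
maximum-present {k} perm = ∈-resp-↭ (↭-sym perm) (∈-map⁺ suc (∈-upTo⁺ (n<1+n k)))


isLabel-absent : ∀ {n} t → n ∉ labels t → isLabel n (rootLabel t) ≡ false
isLabel-absent ∅          _    = refl
isLabel-absent (nd _ b _) n∉t = ≡ᵇ-false (λ b≡n → n∉t (here (sym b≡n)))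

parentOf-absent : ∀ {n} t → n ∉ labels t → parentOf n t ≡ nothing
parentOf-absent ∅          _    = refl
parentOf-absent (nd l a r) n∉t
  rewrite isLabel-absent l (n∉t ∘ ∈-left) | isLabel-absent r (n∉t ∘ ∈-right {l = l})
        | parentOf-absent l (n∉t ∘ ∈-left) | parentOf-absent r (n∉t ∘ ∈-right {l = l}) = refl

parentOf-leftChild : ∀ {n} a r → parentOf n (nd (nd ∅ n ∅) a r) ≡ just a
parentOf-leftChild {n} a r rewrite ≡ᵇ-refl n = refl

parentOf-rightChild : ∀ {n} l a → n ∉ labels l → parentOf n (nd l a (nd ∅ n ∅)) ≡ just a
parentOf-rightChild {n} l a n∉l rewrite isLabel-absent l n∉l | ≡ᵇ-refl n = refl

parentOf-inLeft : ∀ {n} ll b lr a r → b ≢ n → n ∉ labels r →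
                  parentOf n (nd (nd ll b lr) a r) ≡ parentOf n (nd ll b lr)
parentOf-inLeft ll b lr a r b≢n n∉r
  rewrite ≡ᵇ-false b≢n | isLabel-absent r n∉r | parentOf-absent r n∉r = <∣>-identityʳ _

parentOf-inRight : ∀ {n} l a rl c rr → n ∉ labels l → c ≢ n →
                   parentOf n (nd l a (nd rl c rr)) ≡ parentOf n (nd rl c rr)
parentOf-inRight l a rl c rr n∉l c≢n
  rewrite isLabel-absent l n∉l | ≡ᵇ-false c≢n | parentOf-absent l n∉l = refl


parent-is-greater-neighbour :
  ∀ {n} l a r prev rest d → WellLabelled n (nd l a r) → n ∈ labels (nd l a r) →
  prev ≤ a → headOr0 rest ≤ a → (a ≡ n → d ≡ prev ⊔ headOr0 rest) →
  fromMaybe d (parentOf n (nd l a r)) ≡ grnFrom n prev (word (nd l a r) ++ rest)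

-- n lies in the left subtree: its neighbours there are prev and a.
descend-left :
  ∀ {n} ll b lr a r prev rest d → WellLabelled n (nd (nd ll b lr) a r) →
  n ∈ labels (nd ll b lr) → prev ≤ a →
  fromMaybe d (parentOf n (nd (nd ll b lr) a r))
    ≡ grnFrom n prev (word (nd ll b lr) ++ a ∷ word r ++ rest)

-- n lies in the right subtree: its neighbours there are a and rest.
descend-right :
  ∀ {n} l a rl c rr rest d → WellLabelled n (nd l a (nd rl c rr)) →
  n ∈ labels (nd rl c rr) → headOr0 rest ≤ a →
  fromMaybe d (parentOf n (nd l a (nd rl c rr))) ≡ grnFrom n a (word (nd rl c rr) ++ rest)

parent-is-greater-neighbour {n} l a r prev rest d wl n∈t prev≤a next≤a d-at-root
  with a ≟ n
... | yes refl with maximum-is-leaf wl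
...   | refl , refl = trans (d-at-root refl) (sym (grnFrom-hit {n} prev rest))
parent-is-greater-neighbour {n} l a r prev rest d wl n∈t prev≤a next≤a d-at-root
    | no a≢n with child-side l a r a≢n n∈t
parent-is-greater-neighbour {n} (nd ll b lr) a r prev rest d wl n∈t prev≤a next≤a d-at-root
    | no a≢n | inj₁ n∈l =
  trans (descend-left ll b lr a r prev rest d wl n∈l prev≤a)
        (cong (grnFrom n prev) (sym (++-assoc (word (nd ll b lr)) (a ∷ word r) rest)))
parent-is-greater-neighbour {n} l a (nd rl c rr) prev rest d wl n∈t prev≤a next≤a d-at-root
    | no a≢n | inj₂ n∈r = begin
  fromMaybe d (parentOf n (nd l a (nd rl c rr)))
    ≡⟨ descend-right l a rl c rr rest d wl n∈r next≤a ⟩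
  grnFrom n a (word (nd rl c rr) ++ rest)
    ≡⟨ sym (grnFrom-pass prev (word l) _ n∉word-l a≢n) ⟩
  grnFrom n prev (word l ++ a ∷ word (nd rl c rr) ++ rest)
    ≡⟨ cong (grnFrom n prev) (sym (++-assoc (word l) (a ∷ word (nd rl c rr)) rest)) ⟩
  grnFrom n prev (word (nd l a (nd rl c rr)) ++ rest)
    ∎
  where
  open ≡-Reasoning
  n∉word-l : n ∉ word l
  n∉word-l n∈wl = subtrees-disjoint wl (∈-resp-↭ (word-↭-labels l) n∈wl) n∈r

descend-left {n} ll b lr a r prev rest d wl@(incNd a<b _ _ _ , _) n∈l prev≤a with b ≟ n
... | yes refl with maximum-is-leaf (left-part wl)
...   | refl , refl = begin
  fromMaybe d (parentOf n (nd (nd ∅ n ∅) a r))  ≡⟨ cong (fromMaybe d) (parentOf-leftChild {n} a r) ⟩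
  a                                             ≡⟨ sym (m≤n⇒m⊔n≡n prev≤a) ⟩
  prev ⊔ a                                      ≡⟨ sym (grnFrom-hit {n} prev (a ∷ word r ++ rest)) ⟩
  grnFrom n prev (n ∷ a ∷ word r ++ rest)       ∎
  where open ≡-Reasoning
descend-left {n} ll b lr a r prev rest d wl@(incNd a<b _ _ _ , _) n∈l prev≤a | no b≢n = begin
  fromMaybe d (parentOf n (nd (nd ll b lr) a r))
    ≡⟨ cong (fromMaybe d) (parentOf-inLeft ll b lr a r b≢n (subtrees-disjoint wl n∈l)) ⟩
  fromMaybe d (parentOf n (nd ll b lr))
    ≡⟨ parent-is-greater-neighbour ll b lr prev (a ∷ word r ++ rest) d (left-part wl) n∈l
         (≤-trans prev≤a (<⇒≤ a<b)) (<⇒≤ a<b) (⊥-elim ∘ b≢n) ⟩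
  grnFrom n prev (word (nd ll b lr) ++ a ∷ word r ++ rest)
    ∎
  where open ≡-Reasoning

descend-right {n} l a rl c rr rest d wl@(incNd _ a<c _ _ , _) n∈r next≤a with c ≟ n
... | yes refl with maximum-is-leaf (right-part wl)
...   | refl , refl = begin
  fromMaybe d (parentOf n (nd l a (nd ∅ n ∅)))  ≡⟨ cong (fromMaybe d) (parentOf-rightChild l a n∉l) ⟩
  a                                             ≡⟨ sym (m≥n⇒m⊔n≡m next≤a) ⟩
  a ⊔ headOr0 rest                              ≡⟨ sym (grnFrom-hit {n} a rest) ⟩
  grnFrom n a (n ∷ rest)                        ∎
  where
  open ≡-Reasoning
  n∉l : n ∉ labels l
  n∉l n∈l = subtrees-disjoint wl n∈l n∈r
descend-right {n} l a rl c rr rest d wl@(incNd _ a<c _ _ , _) n∈r next≤a | no c≢n = begin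
  fromMaybe d (parentOf n (nd l a (nd rl c rr)))
    ≡⟨ cong (fromMaybe d) (parentOf-inRight l a rl c rr n∉l c≢n) ⟩
  fromMaybe d (parentOf n (nd rl c rr))
    ≡⟨ parent-is-greater-neighbour rl c rr a rest d (right-part wl) n∈r
         (<⇒≤ a<c) (≤-trans next≤a (<⇒≤ a<c)) (⊥-elim ∘ c≢n) ⟩
  grnFrom n a (word (nd rl c rr) ++ rest)
    ∎
  where
  open ≡-Reasoning
  n∉l : n ∉ labels l
  n∉l n∈l = subtrees-disjoint wl n∈l n∈r


-- The whole tree has root 1 and outer neighbours σ(0) = σ(n+1) = 0.
theorem5p1 : (n : ℕ) (t : BT) (σ : List ℕ) → 1 ≤ n → IBTTree n t →
             IsProjection t σ → pom n t ≡ grn n σ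
theorem5p1 zero    _ _ () _ _
theorem5p1 (suc k) t@(nd l 1 r) σ _ (perm , (_ , _ , refl) , inc , _) projection = begin
  pom (suc k) t
    ≡⟨ parent-is-greater-neighbour l 1 r 0 [] 0 (well-labelled {t = t} perm inc)
         (maximum-present {t = t} perm) z≤n z≤n (λ _ → refl) ⟩
  grnFrom (suc k) 0 (word t ++ [])
    ≡⟨ cong (grn (suc k)) (++-identityʳ (word t)) ⟩
  grn (suc k) (word t)
    ≡⟨ cong (grn (suc k)) (sym (projection-is-word t σ projection)) ⟩
  grn (suc k) σ
    ∎
  where open ≡-Reasoning
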